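{- For every frame $\mathfrak F=(W,R_h,R_v)$, $\mathfrak F$ is isomorphic to a product of two difference frames if and only if $R_h$ and $R_v$ are commuting irreflexive pseudo-equivalence relations and every bi-cluster of $\mathfrak F$ is a singleton.
   Context: A difference frame is $(U,\neq_U)$ for a nonempty set $U$; the product $(U,\neq_U)\times(V,\neq_V)$ is the frame on $U\times V$ with $(x,y)\bar R_h(x',y')$ iff $x\ne x'$, $y=y'$, and $(x,y)\bar R_v(x',y')$ iff $y\ne y'$, $x=x'$. A pseudo-equivalence relation is a symmetric relation $R$ with $xRy\wedge yRz\to(x=z\vee xRz)$; commuting means $R_h\circ R_v=R_v\circ R_h$. With $R_h^+,R_v^+$ the reflexive closures, $u\sim v$ iff $uR_h^+v$ and $uR_v^+v$; the bi-clusters of $\mathfrak F$ are the $\sim$-equivalence classes.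
   Formalization: The characterisation covers rooted frames $\mathfrak F$ only, those in which some point reaches every point of W by a finite chain of $R_h$ and $R_v$ steps. The statement above fails without it. -}

module Defs where

open import Level using (0ℓ)
open import Data.Product using (Σ; Σ-syntax; ∃; _×_; _,_)
open import Data.Sum using (_⊎_)
open import Relation.Nullary using (¬_)
open import Relation.Binary.PropositionalEquality using (_≡_; _≢_)
open import Relation.Binary.Construct.Closure.ReflexiveTransitive using (Star)
open import Function.Bundles using (_↔_; _⇔_; Inverse)

record Frame : Set₁ where
  field
    W  : Set
    Rh : W → W → Set
    Rv : W → W → Set
open Frame public

DiffProd : Set → Set → Frame
DiffProd U V = record
  { W  = U × V
  ; Rh = λ { (x , y) (x' , y') → (x ≢ x') × (y ≡ y') }
  ; Rv = λ { (x , y) (x' , y') → (y ≢ y') × (x ≡ x') }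
  }

Iso : Frame → Frame → Set
Iso F G = Σ[ f ∈ (W F ↔ W G) ]
  ((∀ x y → Rh F x y ⇔ Rh G (Inverse.to f x) (Inverse.to f y)) ×
   (∀ x y → Rv F x y ⇔ Rv G (Inverse.to f x) (Inverse.to f y)))

-- F is isomorphic to a product of two difference frames (U, V nonempty).
IsoToDiffProduct : Frame → Set₁
IsoToDiffProduct F = Σ[ U ∈ Set ] Σ[ V ∈ Set ] (U × V × Iso F (DiffProd U V))

module _ {A : Set} where
  Irreflexive : (A → A → Set) → Set
  Irreflexive R = ∀ x → ¬ R x x

  Symmetric : (A → A → Set) → Set
  Symmetric R = ∀ x y → R x y → R y x

  PseudoEquivalence : (A → A → Set) → Set
  PseudoEquivalence R = Symmetric R × (∀ x y z → R x y → R y z → (x ≡ z) ⊎ R x z)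

  _∘ᴿ_ : (A → A → Set) → (A → A → Set) → A → A → Set
  (R ∘ᴿ S) x z = ∃ λ y → R x y × S y z

  Commuting : (A → A → Set) → (A → A → Set) → Set
  Commuting R S = ∀ x z → (R ∘ᴿ S) x z ⇔ (S ∘ᴿ R) x z

  ReflClosure : (A → A → Set) → A → A → Set
  ReflClosure R x y = (x ≡ y) ⊎ R x y

  _∪ᴿ_ : (A → A → Set) → (A → A → Set) → A → A → Set
  (R ∪ᴿ S) x y = R x y ⊎ S x y

Sim : (F : Frame) → W F → W F → Set
Sim F u v = ReflClosure (Rh F) u v × ReflClosure (Rv F) u v

BiCluster : (F : Frame) → W F → W F → Set
BiCluster F u = Sim F u

IsSingleton : {A : Set} → (A → Set) → Set
IsSingleton {A} P = Σ[ x ∈ A ] (P x × (∀ y → P y → y ≡ x))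

AllBiClustersSingleton : Frame → Set
AllBiClustersSingleton F = ∀ u → IsSingleton (BiCluster F u)

Rooted : Frame → Set
Rooted F = Σ[ r ∈ W F ] (∀ w → Star (Rh F ∪ᴿ Rv F) r w)

-- Products of difference frames have the four properties, and they transfer along
-- isomorphisms. Conversely, let ≈ʰ, ≈ᵛ be the reflexive closures of R_h, R_v: they are
-- commuting equivalence relations whose intersection is equality. So ≈ʰ ∘ ≈ᵛ is an
-- equivalence containing R_h ∪ R_v, and from a root r every w has a corner a with
-- r ≈ʰ a ≈ᵛ w; it is unique, as two corners are both ≈ʰ- and ≈ᵛ-related. Taking corners
-- in both orders gives a bijection from W to U × V, where U and V are the ≈ʰ- and
-- ≈ᵛ-classes of r. Finally w R_h w′ iff w ≈ʰ w′ but not w ≈ᵛ w′, that is, iff the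
-- U-coordinates differ and the V-coordinates agree.

module Submission where

open import Defs
open import Level using (0ℓ)
open import Data.Product using (_×_)
open import Function.Bundles using (_⇔_)
open import Axiom.ExcludedMiddle using (ExcludedMiddle)

open import Data.Empty using (⊥-elim)
open import Data.Irrelevant using ([_])
open import Data.Product using (_,_; proj₁; proj₂)
open import Data.Product.Function.NonDependent.Propositional using (_×-⇔_)
open import Data.Refinement using (_,_; Refinement-syntax; value; value-injective)
open import Data.Sum using (_⊎_; inj₁; inj₂)
open import Function.Base using (_∘_; flip)
open import Function.Bundles using (_↔_; Inverse; Injection; Equivalence; mk⇔; mk↔ₛ′)
open import Function.Construct.Composition using (_⇔-∘_)
open import Function.Construct.Identity using (⇔-id)
open import Function.Properties.Inverse using (Inverse⇒Injection)
open import Function.Related.TypeIsomorphisms using (×-comm; ¬-cong-⇔)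
open import Relation.Binary.Core using (Rel; _⇒_)
open import Relation.Binary.Structures using (IsEquivalence)
open import Relation.Binary.PropositionalEquality using (_≡_; refl; sym; trans; cong; cong₂; subst)
open import Relation.Binary.Construct.Closure.ReflexiveTransitive using (Star; ε; _◅_)
open import Relation.Nullary using (¬_; yes; no)
open import Relation.Nullary.Decidable using (recompute)

private variable
  A : Set
  R S : Rel A 0ℓ
  x y w w′ : A

Separated : Rel A 0ℓ → Rel A 0ℓ → Set
Separated R S = ∀ {x y} → ReflClosure R x y → ReflClosure S x y → x ≡ y

allBiClustersSingleton⇔separated : (F : Frame) → AllBiClustersSingleton F ⇔ Separated (Rh F) (Rv F)
allBiClustersSingleton⇔separated F = mk⇔ singleton⇒separated separated⇒singleton
  where
  singleton⇒separated : AllBiClustersSingleton F → Separated (Rh F) (Rv F)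
  singleton⇒separated singletons {u} {v} u≈ʰv u≈ᵛv =
    let _ , _ , unique = singletons u
    in trans (unique u (inj₁ refl , inj₁ refl)) (sym (unique v (u≈ʰv , u≈ᵛv)))

  separated⇒singleton : Separated (Rh F) (Rv F) → AllBiClustersSingleton F
  separated⇒singleton separated u =
    u , (inj₁ refl , inj₁ refl) , λ v (u≈ʰv , u≈ᵛv) → sym (separated u≈ʰv u≈ᵛv)

reflClosure-isEquivalence : PseudoEquivalence R → IsEquivalence (ReflClosure R)
reflClosure-isEquivalence {R = R} (R-sym , R-pseudoTrans) = record
  { refl = inj₁ refl ; sym = R⁺-sym ; trans = R⁺-trans }
  where
  R⁺-sym : ReflClosure R x y → ReflClosure R y x
  R⁺-sym (inj₁ refl) = inj₁ refl
  R⁺-sym (inj₂ xRy)  = inj₂ (R-sym _ _ xRy)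

  R⁺-trans : ∀ {x y z} → ReflClosure R x y → ReflClosure R y z → ReflClosure R x z
  R⁺-trans (inj₁ refl) yR⁺z        = yR⁺z
  R⁺-trans (inj₂ xRy)  (inj₁ refl) = inj₂ xRy
  R⁺-trans (inj₂ xRy)  (inj₂ yRz)  = R-pseudoTrans _ _ _ xRy yRz

reflClosure-commute : (R ∘ᴿ S) ⇒ (S ∘ᴿ R) →
  (ReflClosure R ∘ᴿ ReflClosure S) ⇒ (ReflClosure S ∘ᴿ ReflClosure R)
reflClosure-commute RS⇒SR (_ , inj₁ refl , xS⁺z)       = _ , xS⁺z , inj₁ refl
reflClosure-commute RS⇒SR (_ , inj₂ xRy  , inj₁ refl)  = _ , inj₁ refl , inj₂ xRy
reflClosure-commute RS⇒SR (y , inj₂ xRy  , inj₂ ySz)   =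
  let y′ , xSy′ , y′Rz = RS⇒SR (y , xRy , ySz) in y′ , inj₂ xSy′ , inj₂ y′Rz

R⇔¬S⁺×R⁺ : Irreflexive R → Separated R S → R x y ⇔ (¬ ReflClosure S x y × ReflClosure R x y)
R⇔¬S⁺×R⁺ {R = R} {S = S} {x} {y} irreflexive separated = mk⇔ apart related
  where
  apart : R x y → ¬ ReflClosure S x y × ReflClosure R x y
  apart xRy = (λ xS⁺y → irreflexive x (subst (R x) (sym (separated (inj₂ xRy) xS⁺y)) xRy))
            , inj₂ xRy

  related : ¬ ReflClosure S x y × ReflClosure R x y → R x y
  related (x≉y , inj₁ refl) = ⊥-elim (x≉y (inj₁ refl))
  related (_   , inj₂ xRy)  = xRy

module Rectangular {R S : Rel A 0ℓ} (R-pseudo : PseudoEquivalence R) (S-pseudo : PseudoEquivalence S) where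

  private
    _≈₁_ _≈₂_ : Rel A 0ℓ
    _≈₁_ = ReflClosure R
    _≈₂_ = ReflClosure S
    module ≈₁ = IsEquivalence (reflClosure-isEquivalence R-pseudo)
    module ≈₂ = IsEquivalence (reflClosure-isEquivalence S-pseudo)

  star⇒∘ : (_≈₂_ ∘ᴿ _≈₁_) ⇒ (_≈₁_ ∘ᴿ _≈₂_) → Star (R ∪ᴿ S) ⇒ (_≈₁_ ∘ᴿ _≈₂_)
  star⇒∘ commute ε = _ , ≈₁.refl , ≈₂.refl
  star⇒∘ commute (inj₁ xRy ◅ steps) =
    let a , y≈₁a , a≈₂w = star⇒∘ commute steps
    in a , ≈₁.trans (inj₂ xRy) y≈₁a , a≈₂w
  star⇒∘ commute (inj₂ xSy ◅ steps) =
    let a , y≈₁a , a≈₂w = star⇒∘ commute steps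
        b , x≈₁b , b≈₂a = commute (_ , inj₂ xSy , y≈₁a)
    in b , x≈₁b , ≈₂.trans b≈₂a a≈₂w

  ≈₂⇔corner-≡ : Separated R S → ∀ {r} (c : (_≈₁_ ∘ᴿ _≈₂_) r w) (c′ : (_≈₁_ ∘ᴿ _≈₂_) r w′) →
    w ≈₂ w′ ⇔ proj₁ c ≡ proj₁ c′
  ≈₂⇔corner-≡ separated (a , r≈₁a , a≈₂w) (a′ , r≈₁a′ , a′≈₂w′) = mk⇔
    (λ w≈₂w′ → separated (≈₁.trans (≈₁.sym r≈₁a) r≈₁a′)
                         (≈₂.trans a≈₂w (≈₂.trans w≈₂w′ (≈₂.sym a′≈₂w′))))
    (λ { refl → ≈₂.trans (≈₂.sym a≈₂w) a′≈₂w′ })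

Corresponds : {A B : Set} → A ↔ B → Rel A 0ℓ → Rel B 0ℓ → Set
Corresponds f R R′ = ∀ x y → R x y ⇔ R′ (Inverse.to f x) (Inverse.to f y)

module Transport {A B : Set} (f↔ : A ↔ B) where

  open Inverse f↔ using (strictlyInverseˡ) renaming (to to f; from to f⁻¹)
  open Equivalence using (to; from)

  private variable
    R′ S′ : Rel B 0ℓ

  f-injective : f x ≡ f y → x ≡ y
  f-injective = Injection.injective (Inverse⇒Injection f↔)

  irreflexive : Irreflexive R′ → Corresponds f↔ R R′ → Irreflexive R
  irreflexive irreflexive′ R≅ x = irreflexive′ (f x) ∘ to (R≅ x x)

  pseudoEquivalence : PseudoEquivalence R′ → Corresponds f↔ R R′ → PseudoEquivalence R
  pseudoEquivalence {R = R} (sym′ , pseudoTrans′) R≅ = symmetric , pseudoTrans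
    where
    symmetric : Symmetric R
    symmetric x y = from (R≅ y x) ∘ sym′ _ _ ∘ to (R≅ x y)

    pseudoTrans : ∀ x y z → R x y → R y z → x ≡ z ⊎ R x z
    pseudoTrans x y z xRy yRz with pseudoTrans′ _ _ _ (to (R≅ x y) xRy) (to (R≅ y z) yRz)
    ... | inj₁ fx≡fz   = inj₁ (f-injective fx≡fz)
    ... | inj₂ fxR′fz  = inj₂ (from (R≅ x z) fxR′fz)

  commute : Corresponds f↔ R R′ → Corresponds f↔ S S′ →
    (R′ ∘ᴿ S′) ⇒ (S′ ∘ᴿ R′) → (R ∘ᴿ S) ⇒ (S ∘ᴿ R)
  commute {R′ = R′} {S′ = S′} R≅ S≅ commute′ {x} {z} (y , xRy , ySz) =
    let y′ , fxS′y′ , y′R′fz = commute′ (f y , to (R≅ x y) xRy , to (S≅ y z) ySz)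
    in f⁻¹ y′
     , from (S≅ x (f⁻¹ y′)) (subst (S′ (f x)) (sym (strictlyInverseˡ y′)) fxS′y′)
     , from (R≅ (f⁻¹ y′) z) (subst (λ v → R′ v (f z)) (sym (strictlyInverseˡ y′)) y′R′fz)

  commuting : Commuting R′ S′ → Corresponds f↔ R R′ → Corresponds f↔ S S′ → Commuting R S
  commuting commuting′ R≅ S≅ x z = mk⇔
    (commute R≅ S≅ (to (commuting′ _ _)))
    (commute S≅ R≅ (from (commuting′ _ _)))

  reflClosure : Corresponds f↔ R R′ → ReflClosure R x y → ReflClosure R′ (f x) (f y)
  reflClosure R≅ (inj₁ refl) = inj₁ refl
  reflClosure R≅ (inj₂ xRy)  = inj₂ (to (R≅ _ _) xRy)

  separated : Separated R′ S′ → Corresponds f↔ R R′ → Corresponds f↔ S S′ → Separated R S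
  separated {R′ = R′} {S′ = S′} separated′ R≅ S≅ xR⁺y xS⁺y =
    f-injective (separated′ (reflClosure {R′ = R′} R≅ xR⁺y) (reflClosure {R′ = S′} S≅ xS⁺y))

module _ {U V : Set} where

  swap-corresponds : Corresponds (×-comm U V) (Rv (DiffProd U V)) (Rh (DiffProd V U))
  swap-corresponds (_ , _) (_ , _) = ⇔-id _

  diffProd-irreflexiveʰ : Irreflexive (Rh (DiffProd U V))
  diffProd-irreflexiveʰ (_ , _) (x≢x , _) = x≢x refl

  diffProd-pseudoEquivalenceʰ : ExcludedMiddle 0ℓ → PseudoEquivalence (Rh (DiffProd U V))
  diffProd-pseudoEquivalenceʰ em = symmetric , pseudoTrans
    where
    symmetric : Symmetric (Rh (DiffProd U V))
    symmetric (_ , _) (_ , _) (x≢x′ , refl) = x≢x′ ∘ sym , refl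

    pseudoTrans : ∀ p q s → Rh (DiffProd U V) p q → Rh (DiffProd U V) q s →
                  p ≡ s ⊎ Rh (DiffProd U V) p s
    pseudoTrans (x , _) (_ , _) (x″ , _) (_ , refl) (_ , refl) with em {x ≡ x″}
    ... | yes refl  = inj₁ refl
    ... | no x≢x″   = inj₂ (x≢x″ , refl)

  diffProd-commuting : Commuting (Rh (DiffProd U V)) (Rv (DiffProd U V))
  diffProd-commuting (x , y) (x″ , y″) = mk⇔ hv⇒vh vh⇒hv
    where
    hv⇒vh : (Rh (DiffProd U V) ∘ᴿ Rv (DiffProd U V)) (x , y) (x″ , y″) →
            (Rv (DiffProd U V) ∘ᴿ Rh (DiffProd U V)) (x , y) (x″ , y″)
    hv⇒vh ((_ , _) , (x≢x″ , refl) , (y≢y″ , refl)) = (x , y″) , (y≢y″ , refl) , (x≢x″ , refl)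

    vh⇒hv : (Rv (DiffProd U V) ∘ᴿ Rh (DiffProd U V)) (x , y) (x″ , y″) →
            (Rh (DiffProd U V) ∘ᴿ Rv (DiffProd U V)) (x , y) (x″ , y″)
    vh⇒hv ((_ , _) , (y≢y″ , refl) , (x≢x″ , refl)) = (x″ , y) , (x≢x″ , refl) , (y≢y″ , refl)

  diffProd-separated : Separated (Rh (DiffProd U V)) (Rv (DiffProd U V))
  diffProd-separated                     (inj₁ refl)          _                    = refl
  diffProd-separated                     (inj₂ _)             (inj₁ refl)          = refl
  diffProd-separated {_ , _} {_ , _}     (inj₂ (_ , y≡y′))    (inj₂ (y≢y′ , _))    = ⊥-elim (y≢y′ y≡y′)

diffProd-irreflexiveᵛ : {U V : Set} → Irreflexive (Rv (DiffProd U V))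
diffProd-irreflexiveᵛ = Transport.irreflexive (×-comm _ _) diffProd-irreflexiveʰ swap-corresponds

diffProd-pseudoEquivalenceᵛ : {U V : Set} → ExcludedMiddle 0ℓ → PseudoEquivalence (Rv (DiffProd U V))
diffProd-pseudoEquivalenceᵛ em =
  Transport.pseudoEquivalence (×-comm _ _) (diffProd-pseudoEquivalenceʰ em) swap-corresponds

DiffProductConditions : Frame → Set
DiffProductConditions F =
  Irreflexive (Rh F) × PseudoEquivalence (Rh F) ×
  Irreflexive (Rv F) × PseudoEquivalence (Rv F) ×
  Commuting (Rh F) (Rv F) × AllBiClustersSingleton F

isoToDiffProduct⇒conditions : ExcludedMiddle 0ℓ → (F : Frame) →
  IsoToDiffProduct F → DiffProductConditions F
isoToDiffProduct⇒conditions em F (U , V , _ , _ , f↔ , h≅ , v≅) =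
    irreflexive {R′ = Rh (DiffProd U V)} diffProd-irreflexiveʰ h≅
  , pseudoEquivalence (diffProd-pseudoEquivalenceʰ em) h≅
  , irreflexive {R′ = Rv (DiffProd U V)} diffProd-irreflexiveᵛ v≅
  , pseudoEquivalence (diffProd-pseudoEquivalenceᵛ em) v≅
  , commuting diffProd-commuting h≅ v≅
  , Equivalence.from (allBiClustersSingleton⇔separated F) (separated diffProd-separated h≅ v≅)
  where open Transport f↔

module ProductDecomposition (em : ExcludedMiddle 0ℓ) (F : Frame)
  (irreflexiveʰ : Irreflexive (Rh F)) (pseudoʰ : PseudoEquivalence (Rh F))
  (irreflexiveᵛ : Irreflexive (Rv F)) (pseudoᵛ : PseudoEquivalence (Rv F))
  (commuting : Commuting (Rh F) (Rv F)) (separated : Separated (Rh F) (Rv F))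
  (r : W F) (reach : ∀ w → Star (Rh F ∪ᴿ Rv F) r w) where

  private
    _≈ʰ_ _≈ᵛ_ : Rel (W F) 0ℓ
    _≈ʰ_ = ReflClosure (Rh F)
    _≈ᵛ_ = ReflClosure (Rv F)
    module ≈ʰ = IsEquivalence (reflClosure-isEquivalence pseudoʰ)
    module ≈ᵛ = IsEquivalence (reflClosure-isEquivalence pseudoᵛ)
    module HV = Rectangular pseudoʰ pseudoᵛ
    module VH = Rectangular pseudoᵛ pseudoʰ
    open Equivalence using (to; from)

  hv⇒vh : (_≈ʰ_ ∘ᴿ _≈ᵛ_) ⇒ (_≈ᵛ_ ∘ᴿ _≈ʰ_)
  hv⇒vh = reflClosure-commute (to (commuting _ _))

  vh⇒hv : (_≈ᵛ_ ∘ᴿ _≈ʰ_) ⇒ (_≈ʰ_ ∘ᴿ _≈ᵛ_)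
  vh⇒hv = reflClosure-commute (from (commuting _ _))

  hCorner : ∀ w → (_≈ʰ_ ∘ᴿ _≈ᵛ_) r w
  hCorner w = HV.star⇒∘ vh⇒hv (reach w)

  vCorner : ∀ w → (_≈ᵛ_ ∘ᴿ _≈ʰ_) r w
  vCorner w = hv⇒vh (hCorner w)

  -- The membership proofs are irrelevant, so U and V are genuine subsets of W;
  -- excluded middle recomputes them where the construction needs them.
  U V : Set
  U = [ a ∈ W F ∣ r ≈ʰ a ]
  V = [ b ∈ W F ∣ r ≈ᵛ b ]

  hCoord : W F → U
  hCoord w = let a , r≈ʰa , _ = hCorner w in a , [ r≈ʰa ]

  vCoord : W F → V
  vCoord w = let b , r≈ᵛb , _ = vCorner w in b , [ r≈ᵛb ]

  ≈ᵛ⇔hCoord-≡ : w ≈ᵛ w′ ⇔ hCoord w ≡ hCoord w′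
  ≈ᵛ⇔hCoord-≡ {w} {w′} =
    mk⇔ value-injective (cong value) ⇔-∘ HV.≈₂⇔corner-≡ separated (hCorner w) (hCorner w′)

  ≈ʰ⇔vCoord-≡ : w ≈ʰ w′ ⇔ vCoord w ≡ vCoord w′
  ≈ʰ⇔vCoord-≡ {w} {w′} =
    mk⇔ value-injective (cong value) ⇔-∘ VH.≈₂⇔corner-≡ (flip separated) (vCorner w) (vCorner w′)

  toProduct : W F → U × V
  toProduct w = hCoord w , vCoord w

  meet : (u : U) (v : V) → (_≈ᵛ_ ∘ᴿ _≈ʰ_) (value u) (value v)
  meet (_ , [ r≈ʰa ]) (_ , [ r≈ᵛb ]) = hv⇒vh (r , ≈ʰ.sym (recompute em r≈ʰa) , recompute em r≈ᵛb)

  fromProduct : U × V → W F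
  fromProduct (u , v) = proj₁ (meet u v)

  hCoord-unique : (u : U) → value u ≈ᵛ w → hCoord w ≡ u
  hCoord-unique {w} (a , [ r≈ʰa ]) a≈ᵛw = value-injective
    (to (HV.≈₂⇔corner-≡ separated (hCorner w) (a , recompute em r≈ʰa , a≈ᵛw)) ≈ᵛ.refl)

  vCoord-unique : (v : V) → value v ≈ʰ w → vCoord w ≡ v
  vCoord-unique {w} (b , [ r≈ᵛb ]) b≈ʰw = value-injective
    (to (VH.≈₂⇔corner-≡ (flip separated) (vCorner w) (b , recompute em r≈ᵛb , b≈ʰw)) ≈ʰ.refl)

  toProduct∘fromProduct : ∀ p → toProduct (fromProduct p) ≡ p
  toProduct∘fromProduct (u , v) =
    let _ , u≈ᵛm , m≈ʰv = meet u v
    in cong₂ _,_ (hCoord-unique u u≈ᵛm) (vCoord-unique v (≈ʰ.sym m≈ʰv))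

  toProduct-injective : toProduct w ≡ toProduct w′ → w ≡ w′
  toProduct-injective e = separated
    (from ≈ʰ⇔vCoord-≡ (cong proj₂ e))
    (from ≈ᵛ⇔hCoord-≡ (cong proj₁ e))

  iso : Iso F (DiffProd U V)
  iso = mk↔ₛ′ toProduct fromProduct toProduct∘fromProduct
          (λ w → toProduct-injective (toProduct∘fromProduct (toProduct w)))
      , (λ _ _ → (¬-cong-⇔ ≈ᵛ⇔hCoord-≡ ×-⇔ ≈ʰ⇔vCoord-≡) ⇔-∘ R⇔¬S⁺×R⁺ irreflexiveʰ separated)
      , (λ _ _ → (¬-cong-⇔ ≈ʰ⇔vCoord-≡ ×-⇔ ≈ᵛ⇔hCoord-≡) ⇔-∘ R⇔¬S⁺×R⁺ irreflexiveᵛ (flip separated))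

  isoToDiffProduct : IsoToDiffProduct F
  isoToDiffProduct = U , V , (r , [ ≈ʰ.refl ]) , (r , [ ≈ᵛ.refl ]) , iso

conditions⇒isoToDiffProduct : ExcludedMiddle 0ℓ → (F : Frame) → Rooted F →
  DiffProductConditions F → IsoToDiffProduct F
conditions⇒isoToDiffProduct em F (r , reach) (irrʰ , pseudoʰ , irrᵛ , pseudoᵛ , comm , singletons) =
  ProductDecomposition.isoToDiffProduct em F irrʰ pseudoʰ irrᵛ pseudoᵛ comm
    (Equivalence.to (allBiClustersSingleton⇔separated F) singletons) r reach

corollary4p2 : ExcludedMiddle 0ℓ → (F : Frame) → Rooted F →
    IsoToDiffProduct F ⇔
      (Irreflexive (Rh F) × PseudoEquivalence (Rh F) ×
       Irreflexive (Rv F) × PseudoEquivalence (Rv F) ×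
       Commuting (Rh F) (Rv F) × AllBiClustersSingleton F)
corollary4p2 em F rooted =
  mk⇔ (isoToDiffProduct⇒conditions em F) (conditions⇒isoToDiffProduct em F rooted)
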